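{- Let $n\ge4$ and let $G$ be a maximal connected triangle-free subgraph of $\mathcal D_n$. Let $P=v_1v_2\cdots v_m$ be a path in $G$ containing no two vertices $v_i,v_j$ with $v_i=v_j^*$, and maximal subject to this condition. Then: (a) $v_1$ and $v_m$ are adjacent, so that the induced subgraph on the vertices of $P$ is a cycle; (b) $P^*:=v_1^*v_2^*\cdots v_m^*$ is a path in $G$ whose vertex set is disjoint from that of $P$, and $G$ is the subgraph induced on the vertices of $P$ and $P^*$.
   Context: Let $e_1,\dots,e_n$ be an orthonormal basis of $\mathbb R^n$. $\mathcal D_n$ is the signed graph with the $n(n-1)$ vertices $e_i\pm e_j$ ($1\le i<j\le n$), distinct vertices $u,v$ being joined by an edge of sign $u\cdot v$ whenever $u\cdot v\ne0$. Subgraphs are induced subgraphs. A triangle is a set of three pairwise adjacent vertices. A maximal connected triangle-free subgraph of $\mathcal D_n$ is a connected triangle-free induced subgraph not contained in a strictly larger connected triangle-free induced subgraph of $\mathcal D_n$. For $v=e_i\pm e_j$ ($i<j$) the conjugate vertex is $v^*=e_i\mp e_j$. A path is a sequence of distinct vertices with consecutive ones adjacent; "maximal" means the path cannot be extended to a longer path in $G$ with the same property. -}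

module Defs where

open import Data.Nat using (ℕ; zero; suc; _≤_)
open import Data.Fin using (Fin; toℕ; _≟_) renaming (_<_ to _<ᶠ_)
open import Data.Bool using (Bool; true; false; if_then_else_; not)
open import Data.Integer using (ℤ; 0ℤ; 1ℤ; -1ℤ) renaming (_+_ to _+ℤ_; _*_ to _*ℤ_)
open import Data.List using (List; []; _∷_; _++_; map; length; lookup)
open import Data.List.Membership.Propositional using (_∈_; _∉_)
open import Data.List.Relation.Unary.All using (All)
open import Data.List.Relation.Unary.Linked using (Linked)
open import Data.List.Relation.Unary.Unique.Propositional using (Unique)
open import Data.Product using (_×_; Σ; ∃)
open import Data.Sum using (_⊎_)
open import Data.Empty using (⊥)
open import Relation.Nullary using (¬_; does)
open import Relation.Binary.PropositionalEquality using (_≡_; _≢_)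

-- A vertex e_i + e_j (sign = true) or e_i - e_j (sign = false), i < j.
record Vertex (n : ℕ) : Set where
  constructor vtx
  field
    i    : Fin n
    j    : Fin n
    i<j  : i <ᶠ j
    sign : Bool
open Vertex public

vec : ∀ {n} → Vertex n → Fin n → ℤ
vec v k =
  if does (k ≟ i v) then 1ℤ
  else if does (k ≟ j v) then (if sign v then 1ℤ else -1ℤ)
  else 0ℤ

sumFin : ∀ n → (Fin n → ℤ) → ℤ
sumFin zero    f = 0ℤ
sumFin (suc n) f = f Fin.zero +ℤ sumFin n (λ k → f (Fin.suc k))

_·_ : ∀ {n} → Vertex n → Vertex n → ℤ
_·_ {n} u v = sumFin n (λ k → vec u k *ℤ vec v k)

-- adjacency in D_n (the sign of the edge is u · v; only adjacency matters here)
Adj : ∀ {n} → Vertex n → Vertex n → Set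
Adj u v = u ≢ v × u · v ≢ 0ℤ

conj : ∀ {n} → Vertex n → Vertex n
conj (vtx a b p s) = vtx a b p (not s)

-- induced subgraphs of D_n, given by their (decidable) vertex sets
VSet : ℕ → Set
VSet n = Vertex n → Bool

_∈S_ : ∀ {n} → Vertex n → VSet n → Set
v ∈S S = S v ≡ true

_⊆S_ : ∀ {n} → VSet n → VSet n → Set
S ⊆S T = ∀ v → v ∈S S → v ∈S T

data Reach {n} (S : VSet n) : Vertex n → Vertex n → Set where
  here : ∀ {u} → Reach S u u
  step : ∀ {u w v} → Adj u w → w ∈S S → Reach S w v → Reach S u v

Connected : ∀ {n} → VSet n → Set
Connected S = ∀ u v → u ∈S S → v ∈S S → Reach S u v

TriangleFree : ∀ {n} → VSet n → Set
TriangleFree S = ∀ u v w → u ∈S S → v ∈S S → w ∈S S →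
  Adj u v → Adj v w → Adj u w → ⊥

MaximalConnectedTriangleFree : ∀ {n} → VSet n → Set
MaximalConnectedTriangleFree S =
  Connected S × TriangleFree S ×
  (∀ T → S ⊆S T → Connected T → TriangleFree T → T ⊆S S)

IsPath : ∀ {n} → VSet n → List (Vertex n) → Set
IsPath S P = P ≢ [] × All (_∈S S) P × Linked Adj P × Unique P

ConjFree : ∀ {n} → List (Vertex n) → Set
ConjFree P = ∀ {x y} → x ∈ P → y ∈ P → x ≢ conj y

GoodPath : ∀ {n} → VSet n → List (Vertex n) → Set
GoodPath S P = IsPath S P × ConjFree P

MaximalGoodPath : ∀ {n} → VSet n → List (Vertex n) → Set
MaximalGoodPath S P = GoodPath S P ×
  (∀ A B → GoodPath S (A ++ P ++ B) → A ≡ [] × B ≡ [])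

CycNbr : ℕ → ℕ → ℕ → Set
CycNbr m a b = suc a ≡ b ⊎ suc b ≡ a ⊎ (a ≡ 0 × suc b ≡ m) ⊎ (b ≡ 0 × suc a ≡ m)

InducedCycle : ∀ {n} → List (Vertex n) → Set
InducedCycle P = 3 ≤ length P ×
  (∀ (a b : Fin (length P)) →
     (Adj (lookup P a) (lookup P b) → CycNbr (length P) (toℕ a) (toℕ b)) ×
     (CycNbr (length P) (toℕ a) (toℕ b) → Adj (lookup P a) (lookup P b)))

-- Two distinct vertices of D_n are adjacent exactly when their supports {i, j} share one
-- coordinate; in particular v and v* have the same support and the same neighbours. So in a
-- triangle-free S the S-neighbours of a vertex carry at most two supports, and by maximality S
-- is closed under conjugation and contains every vertex adjacent to S whose S-neighbours are
-- pairwise non-adjacent. Along the maximal conjugate-free path P, an S-neighbour of an interior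
-- vertex has the support of one of its two path neighbours, and an S-neighbour of an end lies in
-- P ∪ P* (otherwise P extends); by connectivity S = P ∪ P*, and the only possible chord of P
-- joins its two ends. If the ends were not adjacent, the far coordinate b of the last vertex
-- would occur in no other vertex of P, and a suitable vertex through b could be added to S: its
-- S-neighbours carry only two non-adjacent supports. When P has one or two vertices, n ≥ 4 is
-- needed to find a coordinate for that vertex outside the vertices of P.

module Submission where

open import Defs
open import Data.Bool using (Bool; true; false; not; if_then_else_; _∨_)
import Data.Bool.Properties as BoolP
open import Data.Empty using (⊥; ⊥-elim)
open import Data.Fin as Fin using (Fin; toℕ) renaming (_<_ to _<ᶠ_)
import Data.Fin.Properties as FinP
open import Data.Integer using (ℤ; 0ℤ; 1ℤ; -1ℤ) renaming (_+_ to _+ℤ_; _*_ to _*ℤ_)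
import Data.Integer.Properties as ℤP
open import Data.Nat using (ℕ; zero; suc; z≤n; s≤s; z<s; _≤_; _<_; ≢-nonZero)
import Data.Nat.Properties as ℕP
open import Data.Nat.Properties using (<⇒≤; <-≤-trans)
open import Data.List using (List; []; _∷_; _++_; map; length; lookup)
open import Data.List.Membership.Propositional using (_∈_; _∉_)
open import Data.List.Membership.Propositional.Properties using (∈-map⁺; ∈-map⁻; ∈-++⁻)
open import Data.List.Relation.Unary.Any using (here; there)
import Data.List.Relation.Unary.All as All
open import Data.List.Relation.Unary.All using (All; _∷_)
import Data.List.Relation.Unary.Linked as Linked
open import Data.List.Relation.Unary.Linked using (Linked; [-]; _∷_)
import Data.List.Relation.Unary.Linked.Properties as LinkedP
open import Data.List.Relation.Unary.Unique.Propositional using (Unique)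
import Data.List.Relation.Unary.AllPairs as AllPairs
open import Data.List.Relation.Unary.AllPairs using (_∷_)
import Data.List.Relation.Unary.All.Properties as AllP
import Data.List.Relation.Unary.Unique.Propositional.Properties as UniqueP
open import Data.List.Properties using (++-identityʳ)
open import Data.Product as Product using (_×_; _,_; proj₁; proj₂; ∃-syntax; ∃₂)
open import Data.Sum as Sum using (_⊎_; inj₁; inj₂)
open import Function using (_∘_)
open import Relation.Nullary using (¬_; Dec; yes; no; does; contradiction)
open import Relation.Nullary.Decidable using (¬?; _×-dec_)
open import Relation.Binary.PropositionalEquality
open import Relation.Binary.Definitions using (tri<; tri≈; tri>)
open import Algebra.Properties.CommutativeSemigroup ℤP.+-commutativeSemigroup using (interchange)

-- Inner products of vertices

sg : Bool → ℤ
sg b = if b then 1ℤ else -1ℤ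

sg≢0 : ∀ b → sg b ≢ 0ℤ
sg≢0 true ()
sg≢0 false ()

sg*sg≢0 : ∀ a b → sg a *ℤ sg b ≢ 0ℤ
sg*sg≢0 true  b = sg≢0 b ∘ trans (sym (ℤP.*-identityˡ (sg b)))
sg*sg≢0 false true ()
sg*sg≢0 false false ()

1+sg-not*sg≡0 : ∀ b → 1ℤ +ℤ sg (not b) *ℤ sg b ≡ 0ℤ
1+sg-not*sg≡0 true  = refl
1+sg-not*sg≡0 false = refl

sumFin-cong : ∀ n {f g : Fin n → ℤ} → (∀ k → f k ≡ g k) → sumFin n f ≡ sumFin n g
sumFin-cong zero    f≗g = refl
sumFin-cong (suc n) f≗g = cong₂ _+ℤ_ (f≗g Fin.zero) (sumFin-cong n (f≗g ∘ Fin.suc))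

sumFin-+ : ∀ n (f g : Fin n → ℤ) → sumFin n (λ k → f k +ℤ g k) ≡ sumFin n f +ℤ sumFin n g
sumFin-+ zero    f g = refl
sumFin-+ (suc n) f g = trans (cong (f Fin.zero +ℤ g Fin.zero +ℤ_) (sumFin-+ n (f ∘ Fin.suc) (g ∘ Fin.suc)))
                             (interchange (f Fin.zero) (g Fin.zero) _ _)

sumFin-* : ∀ n c (f : Fin n → ℤ) → sumFin n (λ k → c *ℤ f k) ≡ c *ℤ sumFin n f
sumFin-* zero    c f = sym (ℤP.*-zeroʳ c)
sumFin-* (suc n) c f = trans (cong (c *ℤ f Fin.zero +ℤ_) (sumFin-* n c (f ∘ Fin.suc)))
                             (sym (ℤP.*-distribˡ-+ c _ _))

δ : ∀ {n} → Fin n → Fin n → ℤ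
δ Fin.zero    Fin.zero    = 1ℤ
δ Fin.zero    (Fin.suc _) = 0ℤ
δ (Fin.suc _) Fin.zero    = 0ℤ
δ (Fin.suc k) (Fin.suc a) = δ k a

δ-refl : ∀ {n} (a : Fin n) → δ a a ≡ 1ℤ
δ-refl Fin.zero    = refl
δ-refl (Fin.suc a) = δ-refl a

δ-≢ : ∀ {n} {k a : Fin n} → k ≢ a → δ k a ≡ 0ℤ
δ-≢ {k = Fin.zero}  {Fin.zero}  k≢a = contradiction refl k≢a
δ-≢ {k = Fin.zero}  {Fin.suc a} k≢a = refl
δ-≢ {k = Fin.suc k} {Fin.zero}  k≢a = refl
δ-≢ {k = Fin.suc k} {Fin.suc a} k≢a = δ-≢ (k≢a ∘ cong Fin.suc)

sumFin-δ : ∀ n (a : Fin n) (g : Fin n → ℤ) → sumFin n (λ k → δ k a *ℤ g k) ≡ g a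
sumFin-δ (suc n) Fin.zero g = begin
    1ℤ *ℤ g Fin.zero +ℤ sumFin n (λ k → 0ℤ *ℤ g (Fin.suc k))
      ≡⟨ cong₂ _+ℤ_ (ℤP.*-identityˡ (g Fin.zero)) (sumFin-zero n {g ∘ Fin.suc}) ⟩
    g Fin.zero +ℤ 0ℤ
      ≡⟨ ℤP.+-identityʳ _ ⟩
    g Fin.zero ∎
  where
  open ≡-Reasoning
  sumFin-zero : ∀ m {h : Fin m → ℤ} → sumFin m (λ k → 0ℤ *ℤ h k) ≡ 0ℤ
  sumFin-zero zero    = refl
  sumFin-zero (suc m) {h} = cong₂ _+ℤ_ (ℤP.*-zeroˡ (h Fin.zero)) (sumFin-zero m {h ∘ Fin.suc})
sumFin-δ (suc n) (Fin.suc a) g = begin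
    0ℤ *ℤ g Fin.zero +ℤ sumFin n (λ k → δ k a *ℤ g (Fin.suc k))
      ≡⟨ cong (_+ℤ sumFin n (λ k → δ k a *ℤ g (Fin.suc k))) (ℤP.*-zeroˡ (g Fin.zero)) ⟩
    0ℤ +ℤ sumFin n (λ k → δ k a *ℤ g (Fin.suc k))
      ≡⟨ ℤP.+-identityˡ _ ⟩
    sumFin n (λ k → δ k a *ℤ g (Fin.suc k))
      ≡⟨ sumFin-δ n a (g ∘ Fin.suc) ⟩
    g (Fin.suc a) ∎
  where open ≡-Reasoning

-- Supports and adjacency

data _∋_ {n} (v : Vertex n) (p : Fin n) : Set where
  ∋i : i v ≡ p → v ∋ p
  ∋j : j v ≡ p → v ∋ p

Meet : ∀ {n} → Vertex n → Vertex n → Set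
Meet u v = ∃[ p ] u ∋ p × v ∋ p

-- e_i + e_j and e_i − e_j are the only vertices with support {i, j}
SameSupport : ∀ {n} → Vertex n → Vertex n → Set
SameSupport u v = u ≡ v ⊎ u ≡ conj v

module _ {n : ℕ} where

  i≢j : (v : Vertex n) → i v ≢ j v
  i≢j v = FinP.<⇒≢ (i<j v)

  _∋?_ : (v : Vertex n) (p : Fin n) → Dec (v ∋ p)
  v ∋? p with i v Fin.≟ p | j v Fin.≟ p
  ... | yes e | _     = yes (∋i e)
  ... | no _  | yes e = yes (∋j e)
  ... | no ¬i | no ¬j = no λ { (∋i e) → ¬i e ; (∋j e) → ¬j e }

  vec-δ : (u : Vertex n) (k : Fin n) → vec u k ≡ δ k (i u) +ℤ sg (sign u) *ℤ δ k (j u)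
  vec-δ u k with k Fin.≟ i u | k Fin.≟ j u
  ... | yes refl | _ rewrite δ-refl k | δ-≢ (i≢j u) | ℤP.*-zeroʳ (sg (sign u)) = refl
  ... | no k≢i | yes refl rewrite δ-refl k | δ-≢ k≢i | ℤP.*-identityʳ (sg (sign u)) = sym (ℤP.+-identityˡ _)
  ... | no k≢i | no k≢j rewrite δ-≢ k≢i | δ-≢ k≢j | ℤP.*-zeroʳ (sg (sign u)) = refl

  ·-expand : (u v : Vertex n) → u · v ≡ vec v (i u) +ℤ sg (sign u) *ℤ vec v (j u)
  ·-expand u v = begin
      sumFin n (λ k → vec u k *ℤ vec v k)
        ≡⟨ sumFin-cong n distribute ⟩
      sumFin n (λ k → δ k (i u) *ℤ vec v k +ℤ sg (sign u) *ℤ (δ k (j u) *ℤ vec v k))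
        ≡⟨ sumFin-+ n (λ k → δ k (i u) *ℤ vec v k) (λ k → sg (sign u) *ℤ (δ k (j u) *ℤ vec v k)) ⟩
      sumFin n (λ k → δ k (i u) *ℤ vec v k) +ℤ sumFin n (λ k → sg (sign u) *ℤ (δ k (j u) *ℤ vec v k))
        ≡⟨ cong (sumFin n (λ k → δ k (i u) *ℤ vec v k) +ℤ_) (sumFin-* n (sg (sign u)) (λ k → δ k (j u) *ℤ vec v k)) ⟩
      sumFin n (λ k → δ k (i u) *ℤ vec v k) +ℤ sg (sign u) *ℤ sumFin n (λ k → δ k (j u) *ℤ vec v k)
        ≡⟨ cong₂ (λ x y → x +ℤ sg (sign u) *ℤ y) (sumFin-δ n (i u) (vec v)) (sumFin-δ n (j u) (vec v)) ⟩
      vec v (i u) +ℤ sg (sign u) *ℤ vec v (j u) ∎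
    where
    open ≡-Reasoning
    distribute : ∀ k → vec u k *ℤ vec v k ≡ δ k (i u) *ℤ vec v k +ℤ sg (sign u) *ℤ (δ k (j u) *ℤ vec v k)
    distribute k = begin
      vec u k *ℤ vec v k
        ≡⟨ cong (_*ℤ vec v k) (vec-δ u k) ⟩
      (δ k (i u) +ℤ sg (sign u) *ℤ δ k (j u)) *ℤ vec v k
        ≡⟨ ℤP.*-distribʳ-+ (vec v k) (δ k (i u)) (sg (sign u) *ℤ δ k (j u)) ⟩
      δ k (i u) *ℤ vec v k +ℤ sg (sign u) *ℤ δ k (j u) *ℤ vec v k
        ≡⟨ cong (δ k (i u) *ℤ vec v k +ℤ_) (ℤP.*-assoc (sg (sign u)) (δ k (j u)) (vec v k)) ⟩
      δ k (i u) *ℤ vec v k +ℤ sg (sign u) *ℤ (δ k (j u) *ℤ vec v k) ∎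

  ·-comm : (u v : Vertex n) → u · v ≡ v · u
  ·-comm u v = sumFin-cong n (λ k → ℤP.*-comm (vec u k) (vec v k))

  vec-∌ : {v : Vertex n} {k : Fin n} → ¬ v ∋ k → vec v k ≡ 0ℤ
  vec-∌ {v} {k} v∌k
    rewrite vec-δ v k | δ-≢ (v∌k ∘ ∋i ∘ sym) | δ-≢ (v∌k ∘ ∋j ∘ sym) | ℤP.*-zeroʳ (sg (sign v)) = refl

  vec-i : (v : Vertex n) → vec v (i v) ≡ 1ℤ
  vec-i v rewrite vec-δ v (i v) | δ-refl (i v) | δ-≢ (i≢j v) | ℤP.*-zeroʳ (sg (sign v)) = refl

  vec-j : (v : Vertex n) → vec v (j v) ≡ sg (sign v)
  vec-j v rewrite vec-δ v (j v) | δ-refl (j v) | δ-≢ (i≢j v ∘ sym) | ℤP.*-identityʳ (sg (sign v)) = ℤP.+-identityˡ _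

  vec-∋ : {v : Vertex n} {k : Fin n} → v ∋ k → ∃[ b ] vec v k ≡ sg b
  vec-∋ {v} (∋i refl) = true , vec-i v
  vec-∋ {v} (∋j refl) = sign v , vec-j v

  vertex-≡ : {u v : Vertex n} → i u ≡ i v → j u ≡ j v → sign u ≡ sign v → u ≡ v
  vertex-≡ {vtx a b a<b s} {vtx .a .b a<b′ .s} refl refl refl = cong (λ lt → vtx a b lt s) (FinP.<-irrelevant a<b a<b′)

  _≟ᵛ_ : (u v : Vertex n) → Dec (u ≡ v)
  u ≟ᵛ v with i u Fin.≟ i v | j u Fin.≟ j v | sign u BoolP.≟ sign v
  ... | yes ei | yes ej | yes es = yes (vertex-≡ ei ej es)
  ... | no ¬ei | _      | _      = no (¬ei ∘ cong i)
  ... | yes _  | no ¬ej | _      = no (¬ej ∘ cong j)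
  ... | yes _  | yes _  | no ¬es = no (¬es ∘ cong sign)

  conj-involutive : (v : Vertex n) → conj (conj v) ≡ v
  conj-involutive v = vertex-≡ refl refl (BoolP.not-involutive (sign v))

  conj-injective : {u v : Vertex n} → conj u ≡ conj v → u ≡ v
  conj-injective {u} {v} e = trans (sym (conj-involutive u)) (trans (cong conj e) (conj-involutive v))

  conj-swap : {x y : Vertex n} → x ≡ conj y → y ≡ conj x
  conj-swap {y = y} refl = sym (conj-involutive y)

  ≢conj : (v : Vertex n) → v ≢ conj v
  ≢conj v = BoolP.not-¬ refl ∘ cong sign

  sameEnds⇒SameSupport : {u v : Vertex n} → i u ≡ i v → j u ≡ j v → SameSupport u v
  sameEnds⇒SameSupport {u} {v} ei ej with sign u BoolP.≟ sign v
  ... | yes es = inj₁ (vertex-≡ ei ej es)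
  ... | no ¬es = inj₂ (vertex-≡ ei ej (BoolP.¬-not ¬es))

  SameSupport? : (u v : Vertex n) → Dec (SameSupport u v)
  SameSupport? u v with u ≟ᵛ v | u ≟ᵛ conj v
  ... | yes e | _     = yes (inj₁ e)
  ... | no _  | yes e = yes (inj₂ e)
  ... | no ¬e | no ¬c = no λ { (inj₁ e) → ¬e e ; (inj₂ c) → ¬c c }

  SameSupport-refl : {u : Vertex n} → SameSupport u u
  SameSupport-refl = inj₁ refl

  SameSupport-sym : {u v : Vertex n} → SameSupport u v → SameSupport v u
  SameSupport-sym           (inj₁ refl) = inj₁ refl
  SameSupport-sym {v = v}   (inj₂ refl) = inj₂ (sym (conj-involutive v))

  SameSupport-trans : {u v w : Vertex n} → SameSupport u v → SameSupport v w → SameSupport u w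
  SameSupport-trans         (inj₁ refl) s           = s
  SameSupport-trans         (inj₂ refl) (inj₁ refl) = inj₂ refl
  SameSupport-trans {w = w} (inj₂ refl) (inj₂ refl) = inj₁ (conj-involutive w)

  SameSupport-conj : (v : Vertex n) → SameSupport (conj v) v
  SameSupport-conj v = inj₂ refl

  ∋-resp : {u v : Vertex n} {p : Fin n} → SameSupport u v → u ∋ p → v ∋ p
  ∋-resp (inj₁ refl) u∋p      = u∋p
  ∋-resp (inj₂ refl) (∋i e)   = ∋i e
  ∋-resp (inj₂ refl) (∋j e)   = ∋j e

  orient : {x : Vertex n} {p q : Fin n} → x ∋ p → x ∋ q → p ≢ q →
           (i x ≡ p × j x ≡ q) ⊎ (i x ≡ q × j x ≡ p)
  orient (∋i e) (∋i e′) p≢q = contradiction (trans (sym e) e′) p≢q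
  orient (∋i e) (∋j e′) p≢q = inj₁ (e , e′)
  orient (∋j e) (∋i e′) p≢q = inj₂ (e′ , e)
  orient (∋j e) (∋j e′) p≢q = contradiction (trans (sym e) e′) p≢q

  ends-unique : {x : Vertex n} {p q r : Fin n} → x ∋ p → x ∋ q → p ≢ q → x ∋ r → r ≡ p ⊎ r ≡ q
  ends-unique x∋p x∋q p≢q x∋r with orient x∋p x∋q p≢q | x∋r
  ... | inj₁ (refl , _) | ∋i refl = inj₁ refl
  ... | inj₁ (_ , refl) | ∋j refl = inj₂ refl
  ... | inj₂ (refl , _) | ∋i refl = inj₂ refl
  ... | inj₂ (_ , refl) | ∋j refl = inj₁ refl

  ∌-third : {x : Vertex n} {p q d : Fin n} → x ∋ p → x ∋ q → p ≢ q → d ≢ p → d ≢ q → ¬ x ∋ d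
  ∌-third x∋p x∋q p≢q d≢p d≢q x∋d with ends-unique x∋p x∋q p≢q x∋d
  ... | inj₁ d≡p = d≢p d≡p
  ... | inj₂ d≡q = d≢q d≡q

  ¬crossedEnds : (u v : Vertex n) → i u ≡ j v → i v ≡ j u → ⊥
  ¬crossedEnds u v e e′ = FinP.<-asym (subst (i v <ᶠ_) (sym e) (i<j v)) (subst (i u <ᶠ_) (sym e′) (i<j u))

  twoPoints⇒SameSupport : {u v : Vertex n} {p q : Fin n} → u ∋ p → u ∋ q → v ∋ p → v ∋ q → p ≢ q →
                          SameSupport u v
  twoPoints⇒SameSupport {u} {v} u∋p u∋q v∋p v∋q p≢q with orient u∋p u∋q p≢q | orient v∋p v∋q p≢q
  ... | inj₁ (a , b) | inj₁ (c , d) = sameEnds⇒SameSupport (trans a (sym c)) (trans b (sym d))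
  ... | inj₂ (a , b) | inj₂ (c , d) = sameEnds⇒SameSupport (trans a (sym c)) (trans b (sym d))
  ... | inj₁ (a , b) | inj₂ (c , d) = ⊥-elim (¬crossedEnds u v (trans a (sym d)) (trans c (sym b)))
  ... | inj₂ (a , b) | inj₁ (c , d) = ⊥-elim (¬crossedEnds v u (trans c (sym b)) (trans a (sym d)))

  Adj-sym : {u v : Vertex n} → Adj u v → Adj v u
  Adj-sym {u} {v} (u≢v , u·v≢0) = u≢v ∘ sym , u·v≢0 ∘ trans (·-comm u v)

  Adj-irrefl : {u : Vertex n} → ¬ Adj u u
  Adj-irrefl (u≢u , _) = u≢u refl

  conj-orthogonal : (v : Vertex n) → conj v · v ≡ 0ℤ
  conj-orthogonal v = begin
    conj v · v
      ≡⟨ ·-expand (conj v) v ⟩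
    vec v (i v) +ℤ sg (not (sign v)) *ℤ vec v (j v)
      ≡⟨ cong₂ (λ x y → x +ℤ sg (not (sign v)) *ℤ y) (vec-i v) (vec-j v) ⟩
    1ℤ +ℤ sg (not (sign v)) *ℤ sg (sign v)
      ≡⟨ 1+sg-not*sg≡0 (sign v) ⟩
    0ℤ ∎
    where open ≡-Reasoning

  Adj⇒¬SameSupport : {u v : Vertex n} → Adj u v → ¬ SameSupport u v
  Adj⇒¬SameSupport (u≢v , _)     (inj₁ e)    = u≢v e
  Adj⇒¬SameSupport {v = v} (_ , u·v≢0) (inj₂ refl) = u·v≢0 (conj-orthogonal v)

  Adj⇒Meet : {u v : Vertex n} → Adj u v → Meet u v
  Adj⇒Meet {u} {v} (_ , u·v≢0) with v ∋? i u | v ∋? j u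
  ... | yes v∋i | _     = i u , ∋i refl , v∋i
  ... | no _    | yes v∋j = j u , ∋j refl , v∋j
  ... | no v∌i  | no v∌j  = contradiction u·v≡0 u·v≢0
    where
    u·v≡0 : u · v ≡ 0ℤ
    u·v≡0 = begin
      u · v
        ≡⟨ ·-expand u v ⟩
      vec v (i u) +ℤ sg (sign u) *ℤ vec v (j u)
        ≡⟨ cong₂ (λ x y → x +ℤ sg (sign u) *ℤ y) (vec-∌ v∌i) (vec-∌ v∌j) ⟩
      0ℤ +ℤ sg (sign u) *ℤ 0ℤ
        ≡⟨ cong (0ℤ +ℤ_) (ℤP.*-zeroʳ (sg (sign u))) ⟩
      0ℤ ∎
      where open ≡-Reasoning

  Meet⇒Adj : {u v : Vertex n} → Meet u v → ¬ SameSupport u v → Adj u v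
  Meet⇒Adj {u} {v} (p , u∋p , v∋p) ¬uv =
    ¬uv ∘ inj₁ , subst (_≢ 0ℤ) (sym (·-expand u v)) (nonzero (v ∋? i u) (v ∋? j u))
    where
    nonzero : Dec (v ∋ i u) → Dec (v ∋ j u) → vec v (i u) +ℤ sg (sign u) *ℤ vec v (j u) ≢ 0ℤ
    nonzero (yes v∋i) (yes v∋j) = contradiction (twoPoints⇒SameSupport (∋i refl) (∋j refl) v∋i v∋j (i≢j u)) ¬uv
    nonzero (yes v∋i) (no v∌j) with vec-∋ v∋i
    ... | b , e rewrite e | vec-∌ v∌j | ℤP.*-zeroʳ (sg (sign u)) | ℤP.+-identityʳ (sg b) = sg≢0 b
    nonzero (no v∌i) (yes v∋j) with vec-∋ v∋j
    ... | b , e rewrite e | vec-∌ v∌i = sg*sg≢0 (sign u) b ∘ trans (sym (ℤP.+-identityˡ _))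
    nonzero (no v∌i) (no v∌j) = contradiction v∋p (missing u∋p)
      where
      missing : u ∋ p → ¬ v ∋ p
      missing (∋i refl) = v∌i
      missing (∋j refl) = v∌j

  Meet⇒SameSupport⊎Adj : {u v : Vertex n} → Meet u v → SameSupport u v ⊎ Adj u v
  Meet⇒SameSupport⊎Adj {u} {v} m with SameSupport? u v
  ... | yes s  = inj₁ s
  ... | no ¬s  = inj₂ (Meet⇒Adj m ¬s)

  Adj-resp-SameSupport : {u v u′ v′ : Vertex n} → SameSupport u u′ → SameSupport v v′ → Adj u v → Adj u′ v′
  Adj-resp-SameSupport uu′ vv′ adj with Adj⇒Meet adj
  ... | p , u∋p , v∋p = Meet⇒Adj (p , ∋-resp uu′ u∋p , ∋-resp vv′ v∋p)
    (λ u′v′ → Adj⇒¬SameSupport adj (SameSupport-trans uu′ (SameSupport-trans u′v′ (SameSupport-sym vv′))))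

  Adj-conj : {u v : Vertex n} → Adj u v → Adj (conj u) (conj v)
  Adj-conj {u} {v} = Adj-resp-SameSupport (SameSupport-sym (SameSupport-conj u)) (SameSupport-sym (SameSupport-conj v))

  otherEnd : {v : Vertex n} {p : Fin n} → v ∋ p → ∃[ q ] v ∋ q × q ≢ p
  otherEnd {v} (∋i refl) = j v , ∋j refl , i≢j v ∘ sym
  otherEnd {v} (∋j refl) = i v , ∋i refl , i≢j v

  vertexThrough : {p q : Fin n} → p ≢ q → ∃[ w ] w ∋ p × w ∋ q
  vertexThrough {p} {q} p≢q with FinP.<-cmp p q
  ... | tri< p<q _ _ = vtx p q p<q true , ∋i refl , ∋j refl
  ... | tri≈ _ p≡q _ = contradiction p≡q p≢q
  ... | tri> _ _ q<p = vtx q p q<p true , ∋j refl , ∋i refl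

-- Triangle-free and maximal subgraphs

module _ {n : ℕ} where

  Reach-mono : {S T : VSet n} {u v : Vertex n} → S ⊆S T → Reach S u v → Reach T u v
  Reach-mono S⊆T here           = here
  Reach-mono S⊆T (step a wS r)  = step a (S⊆T _ wS) (Reach-mono S⊆T r)

  Reach-++ : {S : VSet n} {u v w : Vertex n} → Reach S u v → Reach S v w → Reach S u w
  Reach-++ here          r′ = r′
  Reach-++ (step a wS r) r′ = step a wS (Reach-++ r r′)

module _ {n : ℕ} {S : VSet n} where

  Connected⇒neighbour : Connected S → {x y : Vertex n} → x ∈S S → y ∈S S → x ≢ y → ∃[ s ] s ∈S S × Adj x s
  Connected⇒neighbour conn {x} {y} xS yS x≢y with conn x y xS yS
  ... | here          = contradiction refl x≢y
  ... | step a sS _   = _ , sS , a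

  Connected-closed : Connected S → (C : Vertex n → Set) → (∀ {x y} → C x → y ∈S S → Adj x y → C y) →
                     {v : Vertex n} → C v → v ∈S S → ∀ {u} → u ∈S S → C u
  Connected-closed conn C closed {v} Cv vS {u} uS = along (conn v u vS uS) Cv
    where
    along : ∀ {a b} → Reach S a b → C a → C b
    along here          Ca = Ca
    along (step a wS r) Ca = along r (closed Ca wS a)

  commonEnd⇒SameSupport : TriangleFree S → {x y z : Vertex n} {p : Fin n} → x ∈S S → y ∈S S → z ∈S S →
                          Adj x y → Adj x z → y ∋ p → z ∋ p → SameSupport y z
  commonEnd⇒SameSupport tf xS yS zS xy xz y∋p z∋p with Meet⇒SameSupport⊎Adj (_ , y∋p , z∋p)
  ... | inj₁ s  = s
  ... | inj₂ yz = ⊥-elim (tf _ _ _ xS yS zS xy yz xz)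

  neighbours-two-supports : TriangleFree S → {x y z w : Vertex n} → x ∈S S → y ∈S S → z ∈S S → w ∈S S →
                            Adj x y → Adj x z → Adj x w → ¬ SameSupport y z → SameSupport w y ⊎ SameSupport w z
  neighbours-two-supports tf xS yS zS wS xy xz xw ¬yz
    with Adj⇒Meet xy | Adj⇒Meet xz | Adj⇒Meet xw
  ... | q₁ , x∋q₁ , y∋q₁ | q₂ , x∋q₂ , z∋q₂ | r , x∋r , w∋r with q₁ Fin.≟ q₂
  ...   | yes refl = contradiction (commonEnd⇒SameSupport tf xS yS zS xy xz y∋q₁ z∋q₂) ¬yz
  ...   | no q₁≢q₂ with ends-unique x∋q₁ x∋q₂ q₁≢q₂ x∋r
  ...     | inj₁ refl = inj₁ (commonEnd⇒SameSupport tf xS wS yS xw xy w∋r y∋q₁)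
  ...     | inj₂ refl = inj₂ (commonEnd⇒SameSupport tf xS wS zS xw xz w∋r z∋q₂)

  insert : Vertex n → VSet n
  insert w v = S v ∨ does (v ≟ᵛ w)

  ⊆-insert : {w : Vertex n} → S ⊆S insert w
  ⊆-insert v vS rewrite vS = refl

  ∈-insert : {w : Vertex n} → w ∈S insert w
  ∈-insert {w} with w ≟ᵛ w
  ... | yes _   = BoolP.∨-zeroʳ (S w)
  ... | no w≢w  = contradiction refl w≢w

  ∈-insert⁻ : {w v : Vertex n} → v ∈S insert w → v ∈S S ⊎ v ≡ w
  ∈-insert⁻ {w} {v} v∈ with S v | v ≟ᵛ w
  ... | true  | _     = inj₁ refl
  ... | false | yes e = inj₂ e

  maximal-insert : MaximalConnectedTriangleFree S → {s w : Vertex n} → s ∈S S → Adj s w →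
                   (∀ y z → y ∈S S → z ∈S S → Adj w y → Adj w z → Adj y z → ⊥) → w ∈S S
  maximal-insert (conn , tf , maximal) {s} {w} sS sw neighbours-independent =
    maximal (insert w) ⊆-insert conn⁺ tf⁺ w ∈-insert
    where
    conn⁺ : Connected (insert w)
    conn⁺ u v u∈ v∈ with ∈-insert⁻ u∈ | ∈-insert⁻ v∈
    ... | inj₁ uS   | inj₁ vS   = Reach-mono ⊆-insert (conn u v uS vS)
    ... | inj₁ uS   | inj₂ refl = Reach-++ (Reach-mono ⊆-insert (conn u s uS sS)) (step sw ∈-insert here)
    ... | inj₂ refl | inj₁ vS   = step (Adj-sym sw) (⊆-insert s sS) (Reach-mono ⊆-insert (conn s v sS vS))
    ... | inj₂ refl | inj₂ refl = here
    tf⁺ : TriangleFree (insert w)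
    tf⁺ a b c a∈ b∈ c∈ ab bc ac with ∈-insert⁻ a∈ | ∈-insert⁻ b∈ | ∈-insert⁻ c∈
    ... | inj₁ aS   | inj₁ bS   | inj₁ cS   = tf a b c aS bS cS ab bc ac
    ... | inj₂ refl | inj₁ bS   | inj₁ cS   = neighbours-independent b c bS cS ab ac bc
    ... | inj₁ aS   | inj₂ refl | inj₁ cS   = neighbours-independent a c aS cS (Adj-sym ab) bc ac
    ... | inj₁ aS   | inj₁ bS   | inj₂ refl = neighbours-independent a b aS bS (Adj-sym ac) (Adj-sym bc) ab
    ... | inj₂ refl | inj₂ refl | _         = Adj-irrefl ab
    ... | _         | inj₂ refl | inj₂ refl = Adj-irrefl bc
    ... | inj₂ refl | inj₁ _    | inj₂ refl = Adj-irrefl ac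

  conj-∈S : MaximalConnectedTriangleFree S → {s x : Vertex n} → s ∈S S → x ∈S S → Adj s x → conj x ∈S S
  conj-∈S maxS@(_ , tf , _) {s} {x} sS xS sx =
    maximal-insert maxS sS (Adj-resp-SameSupport SameSupport-refl (SameSupport-sym (SameSupport-conj x)) sx)
      λ y z yS zS x*y x*z yz → tf x y z xS yS zS (via-x x*y) yz (via-x x*z)
    where
    via-x : ∀ {y} → Adj (conj x) y → Adj x y
    via-x = Adj-resp-SameSupport (SameSupport-conj x) SameSupport-refl

  conj-closed : MaximalConnectedTriangleFree S → {u v : Vertex n} → u ∈S S → v ∈S S → u ≢ v →
                ∀ {x} → x ∈S S → conj x ∈S S
  conj-closed maxS@(conn , _) {u} {v} uS vS u≢v {x} xS =
    let s , sS , xs = neighbour (x ≟ᵛ u) in conj-∈S maxS sS xS (Adj-sym xs)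
    where
    neighbour : Dec (x ≡ u) → ∃[ s ] s ∈S S × Adj x s
    neighbour (yes refl) = Connected⇒neighbour conn xS vS u≢v
    neighbour (no x≢u)   = Connected⇒neighbour conn xS uS x≢u

fresh : ∀ {n} → 4 ≤ n → (a b c : Fin n) → ∃[ d ] d ≢ a × d ≢ b × d ≢ c
fresh {n} n≥4 a b c = decide (FinP.any? λ t → ¬? (ι t Fin.≟ a) ×-dec ¬? (ι t Fin.≟ b) ×-dec ¬? (ι t Fin.≟ c))
  where
  ι : Fin 4 → Fin n
  ι t = Fin.inject≤ t n≥4
  pick : Fin 3 → Fin n
  pick Fin.zero                     = a
  pick (Fin.suc Fin.zero)           = b
  pick (Fin.suc (Fin.suc Fin.zero)) = c
  decide : Dec (∃[ t ] ι t ≢ a × ι t ≢ b × ι t ≢ c) → ∃[ d ] d ≢ a × d ≢ b × d ≢ c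
  decide (yes (t , avoids)) = ι t , avoids
  decide (no none) = ⊥-elim (collision (FinP.pigeonhole (ℕP.n<1+n 3) (proj₁ ∘ which)))
    where
    which : (t : Fin 4) → ∃[ s ] ι t ≡ pick s
    which t with ι t Fin.≟ a | ι t Fin.≟ b | ι t Fin.≟ c
    ... | yes e | _     | _     = Fin.zero , e
    ... | no _  | yes e | _     = Fin.suc Fin.zero , e
    ... | no _  | no _  | yes e = Fin.suc (Fin.suc Fin.zero) , e
    ... | no ¬a | no ¬b | no ¬c = contradiction (t , ¬a , ¬b , ¬c) none
    collision : ¬ ∃₂ λ t₁ t₂ → t₁ Fin.< t₂ × proj₁ (which t₁) ≡ proj₁ (which t₂)
    collision (t₁ , t₂ , t₁<t₂ , same) = FinP.<⇒≢ t₁<t₂ (FinP.inject≤-injective n≥4 n≥4 t₁ t₂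
      (trans (proj₂ (which t₁)) (trans (cong pick same) (sym (proj₂ (which t₂))))))

-- Lists indexed by natural numbers

module _ {A : Set} where

  nth : A → List A → ℕ → A
  nth d []       _       = d
  nth d (x ∷ xs) zero    = x
  nth d (x ∷ xs) (suc k) = nth d xs k

  nth-∈ : (d : A) {xs : List A} {k : ℕ} → k < length xs → nth d xs k ∈ xs
  nth-∈ d {x ∷ xs} {zero}  _         = here refl
  nth-∈ d {x ∷ xs} {suc k} (s≤s k<) = there (nth-∈ d k<)

  ∈⇒nth : (d : A) {x : A} {xs : List A} → x ∈ xs → ∃[ k ] k < length xs × x ≡ nth d xs k
  ∈⇒nth d (here refl) = 0 , s≤s z≤n , refl
  ∈⇒nth d (there x∈) with ∈⇒nth d x∈
  ... | k , k< , e = suc k , s≤s k< , e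

  nth-injective : (d : A) {xs : List A} {k k′ : ℕ} → Unique xs → k < length xs → k′ < length xs →
                  nth d xs k ≡ nth d xs k′ → k ≡ k′
  nth-injective d {x ∷ xs} {zero}  {zero}   _         _        _          _ = refl
  nth-injective d {x ∷ xs} {zero}  {suc k′} (x∉ ∷ _) _        (s≤s k′<) e = contradiction e (All.lookup x∉ (nth-∈ d k′<))
  nth-injective d {x ∷ xs} {suc k} {zero}   (x∉ ∷ _) (s≤s k<) _          e = contradiction (sym e) (All.lookup x∉ (nth-∈ d k<))
  nth-injective d {x ∷ xs} {suc k} {suc k′} (_ ∷ u)  (s≤s k<) (s≤s k′<) e = cong suc (nth-injective d u k< k′< e)

  Linked⇒nth : (d : A) {R : A → A → Set} {xs : List A} {k : ℕ} → Linked R xs → suc k < length xs →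
               R (nth d xs k) (nth d xs (suc k))
  Linked⇒nth d {k = zero}  (r ∷ _) _          = r
  Linked⇒nth d {k = suc k} (_ ∷ l) (s≤s k+1<) = Linked⇒nth d l k+1<
  Linked⇒nth d {k = zero}  [-]     (s≤s ())
  Linked⇒nth d {k = suc k} [-]     (s≤s ())

  lookup≡nth : (d : A) (xs : List A) (a : Fin (length xs)) → lookup xs a ≡ nth d xs (toℕ a)
  lookup≡nth d (x ∷ xs) Fin.zero    = refl
  lookup≡nth d (x ∷ xs) (Fin.suc a) = lookup≡nth d xs a

  nth-last : (d x : A) (xs : List A) (y : A) → nth d (x ∷ xs ++ y ∷ []) (length (xs ++ y ∷ [])) ≡ y
  nth-last d x []        y = refl
  nth-last d x (x′ ∷ xs) y = nth-last d x′ xs y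

  Linked-∷ʳ : (d : A) {R : A → A → Set} {x y : A} {xs : List A} → Linked R (x ∷ xs) →
              R (nth d (x ∷ xs) (length xs)) y → Linked R (x ∷ xs ++ y ∷ [])
  Linked-∷ʳ d [-]      r = r ∷ [-]
  Linked-∷ʳ d (r′ ∷ l) r = r′ ∷ Linked-∷ʳ d l r

  first-last : {R : A → A → Set} {x : A} {xs : List A} → R x (nth x (x ∷ xs) (length xs)) →
               ∀ v₁ mid vₘ → x ∷ xs ≡ v₁ ∷ mid ++ vₘ ∷ [] → R v₁ vₘ
  first-last {R} r v₁ mid vₘ refl = subst (R v₁) (nth-last v₁ v₁ mid vₘ) r

-- Maximal conjugate-free paths

module _ {n : ℕ} where

  ConjFree-extend : {P Q : List (Vertex n)} {y : Vertex n} → ConjFree P → y ∉ map conj P →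
                    (∀ {x} → x ∈ Q → x ∈ P ⊎ x ≡ y) → ConjFree Q
  ConjFree-extend {P} {y = y} conjFree y∉P* Q⊆P+y x∈ x′∈ x≡x′* with Q⊆P+y x∈ | Q⊆P+y x′∈
  ... | inj₁ x∈P  | inj₁ x′∈P = conjFree x∈P x′∈P x≡x′*
  ... | inj₁ x∈P  | inj₂ refl = y∉P* (subst (_∈ map conj P) (sym (conj-swap x≡x′*)) (∈-map⁺ conj x∈P))
  ... | inj₂ refl | inj₁ x′∈P = y∉P* (subst (_∈ map conj P) (sym x≡x′*) (∈-map⁺ conj x′∈P))
  ... | inj₂ refl | inj₂ refl = ≢conj y x≡x′*

module MaximalPath {n : ℕ} (n≥4 : 4 ≤ n) {S : VSet n} (maxS : MaximalConnectedTriangleFree S)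
                   {v₀ : Vertex n} {rest : List (Vertex n)}
                   (P⊆S : All (_∈S S) (v₀ ∷ rest)) (linked : Linked Adj (v₀ ∷ rest))
                   (unique : Unique (v₀ ∷ rest)) (conjFree : ConjFree (v₀ ∷ rest))
                   (unextendable : ∀ A B → GoodPath S (A ++ (v₀ ∷ rest) ++ B) → A ≡ [] × B ≡ []) where

  P : List (Vertex n)
  P = v₀ ∷ rest

  L : ℕ
  L = length rest

  at : ℕ → Vertex n
  at = nth v₀ P

  open import Data.List.Membership.DecPropositional (_≟ᵛ_ {n}) using (_∈?_)

  private
    conn : Connected S
    conn = proj₁ maxS
    tf : TriangleFree S
    tf = proj₁ (proj₂ maxS)

  at-∈S : ∀ {k} → k ≤ L → at k ∈S S
  at-∈S k≤L = All.lookup P⊆S (nth-∈ v₀ (s≤s k≤L))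

  at-adj : ∀ {k} → k < L → Adj (at k) (at (suc k))
  at-adj k<L = Linked⇒nth v₀ linked (s≤s k<L)

  at-SameSupport⇒≡ : ∀ {k k′} → k ≤ L → k′ ≤ L → SameSupport (at k) (at k′) → k ≡ k′
  at-SameSupport⇒≡ k≤L k′≤L (inj₁ e) = nth-injective v₀ unique (s≤s k≤L) (s≤s k′≤L) e
  at-SameSupport⇒≡ k≤L k′≤L (inj₂ e) = contradiction e (conjFree (nth-∈ v₀ (s≤s k≤L)) (nth-∈ v₀ (s≤s k′≤L)))

  OnPathSupport : Vertex n → Set
  OnPathSupport y = ∃[ k ] k ≤ L × SameSupport y (at k)

  ∈P∪P*⇒OnPathSupport : ∀ {y} → y ∈ P ⊎ y ∈ map conj P → OnPathSupport y
  ∈P∪P*⇒OnPathSupport (inj₁ y∈P) with ∈⇒nth v₀ y∈P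
  ... | k , s≤s k≤L , e = k , k≤L , inj₁ e
  ∈P∪P*⇒OnPathSupport (inj₂ y∈P*) with ∈-map⁻ conj y∈P*
  ... | x , x∈P , refl with ∈⇒nth v₀ x∈P
  ...   | k , s≤s k≤L , e = k , k≤L , inj₂ (cong conj e)

  OnPathSupport⇒∈P∪P* : ∀ {y} → OnPathSupport y → y ∈ P ⊎ y ∈ map conj P
  OnPathSupport⇒∈P∪P* (k , k≤L , inj₁ refl) = inj₁ (nth-∈ v₀ (s≤s k≤L))
  OnPathSupport⇒∈P∪P* (k , k≤L , inj₂ refl) = inj₂ (∈-map⁺ conj (nth-∈ v₀ (s≤s k≤L)))

  OnPathSupport-stable : ∀ y → ¬ (y ∉ P × y ∉ map conj P) → OnPathSupport y
  OnPathSupport-stable y ¬new with y ∈? P | y ∈? map conj P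
  ... | yes y∈P | _         = ∈P∪P*⇒OnPathSupport (inj₁ y∈P)
  ... | no _    | yes y∈P* = ∈P∪P*⇒OnPathSupport (inj₂ y∈P*)
  ... | no y∉P  | no y∉P*  = contradiction (y∉P , y∉P*) ¬new

  last-neighbour : ∀ {y} → y ∈S S → Adj (at L) y → OnPathSupport y
  last-neighbour {y} yS last~y = OnPathSupport-stable y λ (y∉P , y∉P*) →
    contradiction (proj₂ (unextendable [] (y ∷ []) (extended y∉P y∉P*))) λ ()
    where
    extended : y ∉ P → y ∉ map conj P → GoodPath S (P ++ y ∷ [])
    extended y∉P y∉P* =
        ( (λ ())
        , AllP.++⁺ P⊆S (yS ∷ All.[])
        , Linked-∷ʳ v₀ linked last~y
        , UniqueP.++⁺ unique (All.[] ∷ AllPairs.[]) (λ { (y∈P , here refl) → y∉P y∈P }))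
      , ConjFree-extend conjFree y∉P* λ {x} x∈ → Sum.map₂ (λ { (here e) → e }) (∈-++⁻ P x∈)

  first-neighbour : ∀ {y} → y ∈S S → Adj y v₀ → OnPathSupport y
  first-neighbour {y} yS y~first = OnPathSupport-stable y λ (y∉P , y∉P*) →
    contradiction (proj₁ (unextendable (y ∷ []) [] (subst (λ Q → GoodPath S (y ∷ Q)) (sym (++-identityʳ P))
                                                           (extended y∉P y∉P*)))) λ ()
    where
    extended : y ∉ P → y ∉ map conj P → GoodPath S (y ∷ P)
    extended y∉P y∉P* =
        ( (λ ())
        , yS ∷ P⊆S
        , y~first ∷ linked
        , All.tabulate (λ x∈P y≡x → y∉P (subst (_∈ P) (sym y≡x) x∈P)) ∷ unique)
      , ConjFree-extend conjFree y∉P* λ { (here e) → inj₂ e ; (there x∈P) → inj₁ x∈P }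

  interior-neighbour : ∀ {k y} → suc k < L → y ∈S S → Adj (at (suc k)) y →
                       SameSupport y (at k) ⊎ SameSupport y (at (suc (suc k)))
  interior-neighbour {k} k+1<L yS adj =
    neighbours-two-supports tf (at-∈S (<⇒≤ k+1<L)) (at-∈S k≤L) (at-∈S k+1<L) yS
      (Adj-sym (at-adj k<L)) (at-adj k+1<L) adj (ℕP.m≢1+n+m k {1} ∘ at-SameSupport⇒≡ k≤L k+1<L)
    where
    k<L = ℕP.<-trans (ℕP.n<1+n k) k+1<L
    k≤L = <⇒≤ k<L

  neighbour-OnPathSupport : ∀ {k y} → k ≤ L → y ∈S S → Adj (at k) y → OnPathSupport y
  neighbour-OnPathSupport {k} k≤L yS adj with ℕP.m≤n⇒m<n∨m≡n k≤L
  neighbour-OnPathSupport {_}     _ yS adj | inj₂ refl = last-neighbour yS adj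
  neighbour-OnPathSupport {zero}  _ yS adj | inj₁ _    = first-neighbour yS (Adj-sym adj)
  neighbour-OnPathSupport {suc k} _ yS adj | inj₁ k+1<L with interior-neighbour k+1<L yS adj
  ... | inj₁ s = k , <⇒≤ (ℕP.<-trans (ℕP.n<1+n k) k+1<L) , s
  ... | inj₂ s = suc (suc k) , k+1<L , s

  S⊆OnPathSupport : ∀ {y} → y ∈S S → OnPathSupport y
  S⊆OnPathSupport = Connected-closed conn OnPathSupport closed (0 , z≤n , SameSupport-refl) (at-∈S z≤n)
    where
    closed : ∀ {x y} → OnPathSupport x → y ∈S S → Adj x y → OnPathSupport y
    closed (k , k≤L , s) yS adj = neighbour-OnPathSupport k≤L yS (Adj-resp-SameSupport s SameSupport-refl adj)

  chord : ∀ {a b} → a < b → b ≤ L → Adj (at a) (at b) → b ≡ suc a ⊎ (a ≡ 0 × b ≡ L)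
  chord {suc a} {b} a+1<b b≤L adj with interior-neighbour (<-≤-trans a+1<b b≤L) (at-∈S b≤L) adj
  ... | inj₁ s = contradiction (at-SameSupport⇒≡ b≤L (<⇒≤ (<-≤-trans (ℕP.<-trans (ℕP.n<1+n a) a+1<b) b≤L)) s)
                               (ℕP.>⇒≢ (ℕP.<-trans (ℕP.n<1+n a) a+1<b))
  ... | inj₂ s = inj₁ (at-SameSupport⇒≡ b≤L (<-≤-trans a+1<b b≤L) s)
  chord {zero} {suc zero}    _ b≤L adj = inj₁ refl
  chord {zero} {suc (suc b)} _ b≤L adj with ℕP.m≤n⇒m<n∨m≡n b≤L
  ... | inj₂ b≡L = inj₂ (refl , b≡L)
  ... | inj₁ b<L with interior-neighbour b<L (at-∈S z≤n) (Adj-sym adj)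
  ...   | inj₁ s = contradiction (at-SameSupport⇒≡ z≤n (<⇒≤ (ℕP.<-trans (ℕP.n<1+n (suc b)) b<L)) s) λ ()
  ...   | inj₂ s = contradiction (at-SameSupport⇒≡ z≤n b<L s) λ ()

  freeEnd-support : ∀ {c x₀ y} → 1 ≤ L → v₀ ∋ c → at 1 ∋ c → v₀ ∋ x₀ → x₀ ≢ c → y ∈S S → y ∋ x₀ →
                    SameSupport y v₀ ⊎ SameSupport y (at L)
  freeEnd-support {c} {x₀} {y} 1≤L v₀∋c v₁∋c v₀∋x₀ x₀≢c yS y∋x₀ with S⊆OnPathSupport yS
  ... | zero  , _     , s = inj₁ s
  ... | suc k , k+1≤L , s
    with chord z<s k+1≤L (Meet⇒Adj (x₀ , v₀∋x₀ , ∋-resp s y∋x₀)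
                                   (λ s′ → contradiction (at-SameSupport⇒≡ z≤n k+1≤L s′) λ ()))
  ...   | inj₁ refl    = contradiction (at-SameSupport⇒≡ z≤n 1≤L
                           (twoPoints⇒SameSupport v₀∋c v₀∋x₀ v₁∋c (∋-resp s y∋x₀) (x₀≢c ∘ sym))) λ ()
  ...   | inj₂ (_ , e) = inj₂ (subst (SameSupport y ∘ at) e s)

  OnlyInLast : Fin n → Set
  OnlyInLast b = ∀ {k} → k < L → ¬ at k ∋ b

  onlyInLast-support : ∀ {b y} → OnlyInLast b → y ∈S S → y ∋ b → SameSupport y (at L)
  onlyInLast-support only yS y∋b with S⊆OnPathSupport yS
  ... | k , k≤L , s with ℕP.m≤n⇒m<n∨m≡n k≤L
  ...   | inj₁ k<L  = contradiction (∋-resp s y∋b) (only k<L)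
  ...   | inj₂ refl = s

  onlyInLast-unextendable :
    ∀ {b w u₁ u₂} → OnlyInLast b → at L ∋ b → w ∋ b → ¬ SameSupport w (at L) → ¬ Adj u₁ u₂ →
    (∀ {y} → y ∈S S → Adj w y → SameSupport y u₁ ⊎ SameSupport y u₂) → ⊥
  onlyInLast-unextendable {b} {w} only last∋b w∋b w≁last ¬u₁~u₂ classify =
    w≁last (onlyInLast-support only w∈S w∋b)
    where
    independent : ∀ y z → y ∈S S → z ∈S S → Adj w y → Adj w z → Adj y z → ⊥
    independent y z yS zS wy wz yz with classify yS wy | classify zS wz
    ... | inj₁ y₁ | inj₁ z₁ = Adj⇒¬SameSupport yz (SameSupport-trans y₁ (SameSupport-sym z₁))
    ... | inj₂ y₂ | inj₂ z₂ = Adj⇒¬SameSupport yz (SameSupport-trans y₂ (SameSupport-sym z₂))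
    ... | inj₁ y₁ | inj₂ z₂ = ¬u₁~u₂ (Adj-resp-SameSupport y₁ z₂ yz)
    ... | inj₂ y₂ | inj₁ z₁ = ¬u₁~u₂ (Adj-sym (Adj-resp-SameSupport y₂ z₁ yz))
    w∈S : w ∈S S
    w∈S = maximal-insert maxS (at-∈S ℕP.≤-refl) (Meet⇒Adj (b , last∋b , w∋b) (w≁last ∘ SameSupport-sym))
                         independent

  L≢0 : L ≢ 0
  L≢0 L≡0 =
    let d , d≢i , d≢j , _ = fresh n≥4 (i (at L)) (j (at L)) (j (at L))
        w , w∋j , w∋d     = vertexThrough (d≢j ∘ sym)
    in onlyInLast-unextendable only (∋j refl) w∋j
         (λ s → ∌-third (∋i refl) (∋j refl) (i≢j (at L)) d≢i d≢j (∋-resp s w∋d))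
         Adj-irrefl (λ yS _ → inj₁ (S⊆last yS))
    where
    only : OnlyInLast (j (at L))
    only {k} k<L = contradiction (subst (k <_) L≡0 k<L) λ ()
    S⊆last : ∀ {y} → y ∈S S → SameSupport y (at L)
    S⊆last yS with S⊆OnPathSupport yS
    ... | k , k≤L , s with ℕP.≤-antisym k≤L (subst (_≤ k) (sym L≡0) z≤n)
    ...   | refl = s

  penultimate-adj : ∀ {L′} → L ≡ suc L′ → Adj (at L′) (at L)
  penultimate-adj {L′} L≡ = subst (Adj (at L′) ∘ at) (sym L≡) (at-adj (subst (L′ <_) (sym L≡) ℕP.≤-refl))

  module LastEdge {L′ : ℕ} (L≡ : L ≡ suc L′)
                  {a b : Fin n} (pen∋a : at L′ ∋ a) (last∋a : at L ∋ a) (last∋b : at L ∋ b) (b≢a : b ≢ a) where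

    L′<L : L′ < L
    L′<L = subst (L′ <_) (sym L≡) (ℕP.n<1+n L′)

    0<L : 0 < L
    0<L = subst (0 <_) (sym L≡) z<s

    pen∌b : ¬ at L′ ∋ b
    pen∌b pen∋b = ℕP.<⇒≢ L′<L
      (at-SameSupport⇒≡ (<⇒≤ L′<L) ℕP.≤-refl (twoPoints⇒SameSupport pen∋a pen∋b last∋a last∋b (b≢a ∘ sym)))

    b-in-earlier-vertex : ∀ {k} → k < L → at k ∋ b → Adj v₀ (at L) × 1 ≤ L′
    b-in-earlier-vertex {k} k<L k∋b = conclude (chord k<L ℕP.≤-refl k~last)
      where
      k~last : Adj (at k) (at L)
      k~last = Meet⇒Adj (b , k∋b , last∋b) (ℕP.<⇒≢ k<L ∘ at-SameSupport⇒≡ (<⇒≤ k<L) ℕP.≤-refl)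
      k≢L′ : k ≢ L′
      k≢L′ k≡L′ = pen∌b (subst (λ t → at t ∋ b) k≡L′ k∋b)
      conclude : L ≡ suc k ⊎ (k ≡ 0 × L ≡ L) → Adj v₀ (at L) × 1 ≤ L′
      conclude (inj₁ L≡k+1)  = contradiction (ℕP.suc-injective (trans (sym L≡k+1) L≡)) k≢L′
      conclude (inj₂ (k≡0 , _)) = subst (λ t → Adj (at t) (at L)) k≡0 k~last
                                , ℕP.n≢0⇒n>0 (k≢L′ ∘ trans k≡0 ∘ sym)

    first∌a : 1 ≤ L′ → ¬ v₀ ∋ a
    first∌a 1≤L′ v₀∋a = ℕP.<⇒≢ 0<L (at-SameSupport⇒≡ z≤n ℕP.≤-refl
      (commonEnd⇒SameSupport tf (at-∈S (<⇒≤ L′<L)) (at-∈S z≤n) (at-∈S ℕP.≤-refl)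
        (Meet⇒Adj (a , pen∋a , v₀∋a) (ℕP.<⇒≢ 1≤L′ ∘ sym ∘ at-SameSupport⇒≡ (<⇒≤ L′<L) z≤n))
        (penultimate-adj L≡) v₀∋a last∋a))

    -- The vertex through b and the free end x₀ of v₀ would close a triangle with v₀ and the last
    -- vertex, hence the fresh coordinate d.
    extension-length2 : L′ ≡ 0 → OnlyInLast b → ∀ {x₀ d w} → v₀ ∋ x₀ → x₀ ≢ a →
                           d ≢ a → d ≢ b → d ≢ x₀ → w ∋ b → w ∋ d → ⊥
    extension-length2 L′≡0 only {x₀} {d} {w} v₀∋x₀ x₀≢a d≢a d≢b d≢x₀ w∋b w∋d =
      onlyInLast-unextendable only last∋b w∋b
        (λ s → ∌-third last∋a last∋b (b≢a ∘ sym) d≢a d≢b (∋-resp s w∋d))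
        Adj-irrefl (λ yS wy → inj₁ (neighbour yS wy))
      where
      v₀∋a : v₀ ∋ a
      v₀∋a = subst (λ t → at t ∋ a) L′≡0 pen∋a
      w≁v₀ : ¬ Adj w v₀
      w≁v₀ w~v₀ with Adj⇒Meet w~v₀
      ... | r , w∋r , v₀∋r with ends-unique w∋b w∋d (d≢b ∘ sym) w∋r
      ...   | inj₁ refl = only 0<L v₀∋r
      ...   | inj₂ refl = ∌-third v₀∋a v₀∋x₀ (x₀≢a ∘ sym) d≢a d≢x₀ v₀∋r
      neighbour : ∀ {y} → y ∈S S → Adj w y → SameSupport y (at L)
      neighbour {y} yS wy with S⊆OnPathSupport yS
      ... | k , k≤L , s with ℕP.m≤n⇒m<n∨m≡n k≤L
      ...   | inj₂ refl = s
      ...   | inj₁ k<L with ℕP.n<1⇒n≡0 (subst (k <_) (trans L≡ (cong suc L′≡0)) k<L)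
      ...     | refl = ⊥-elim (w≁v₀ (Adj-resp-SameSupport SameSupport-refl s wy))

    onlyInLast-length2 : L′ ≡ 0 → OnlyInLast b → ⊥
    onlyInLast-length2 L′≡0 only =
      let x₀ , v₀∋x₀ , x₀≢a     = otherEnd (subst (λ t → at t ∋ a) L′≡0 pen∋a)
          d , d≢a , d≢b , d≢x₀ = fresh n≥4 a b x₀
          w , w∋b , w∋d         = vertexThrough (d≢b ∘ sym)
      in extension-length2 L′≡0 only v₀∋x₀ x₀≢a d≢a d≢b d≢x₀ w∋b w∋d

    -- The vertex through b and the free end x₀ of v₀ meets only S-vertices with the support of v₀
    -- or of the last vertex, and those two are not adjacent.
    extension-length≥3 : 1 ≤ L′ → OnlyInLast b → ∀ {c x₀ w} → v₀ ∋ c → at 1 ∋ c → v₀ ∋ x₀ → x₀ ≢ c →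
                       w ∋ b → w ∋ x₀ → ⊥
    extension-length≥3 1≤L′ only {c} {x₀} {w} v₀∋c v₁∋c v₀∋x₀ x₀≢c w∋b w∋x₀ =
      onlyInLast-unextendable only last∋b w∋b
        (λ s → ∌-third last∋a last∋b (b≢a ∘ sym) x₀≢a x₀≢b (∋-resp s w∋x₀))
        v₀≁last classify
      where
      1≤L : 1 ≤ L
      1≤L = ℕP.≤-trans 1≤L′ (<⇒≤ L′<L)
      v₀∌a : ¬ v₀ ∋ a
      v₀∌a = first∌a 1≤L′
      v₀∌b : ¬ v₀ ∋ b
      v₀∌b = only 0<L
      x₀≢a : x₀ ≢ a
      x₀≢a refl = v₀∌a v₀∋x₀
      x₀≢b : x₀ ≢ b
      x₀≢b refl = v₀∌b v₀∋x₀
      v₀≁last : ¬ Adj v₀ (at L)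
      v₀≁last v₀~last with Adj⇒Meet v₀~last
      ... | r , v₀∋r , last∋r with ends-unique last∋a last∋b (b≢a ∘ sym) last∋r
      ...   | inj₁ refl = v₀∌a v₀∋r
      ...   | inj₂ refl = v₀∌b v₀∋r
      classify : ∀ {y} → y ∈S S → Adj w y → SameSupport y v₀ ⊎ SameSupport y (at L)
      classify yS wy with Adj⇒Meet wy
      ... | r , w∋r , y∋r with ends-unique w∋b w∋x₀ (x₀≢b ∘ sym) w∋r
      ...   | inj₁ refl = inj₂ (onlyInLast-support only yS y∋r)
      ...   | inj₂ refl = freeEnd-support 1≤L v₀∋c v₁∋c v₀∋x₀ x₀≢c yS y∋r

    onlyInLast-length≥3 : 1 ≤ L′ → OnlyInLast b → ⊥
    onlyInLast-length≥3 1≤L′ only =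
      let c , v₀∋c , v₁∋c   = Adj⇒Meet (at-adj 0<L)
          x₀ , v₀∋x₀ , x₀≢c = otherEnd v₀∋c
          w , w∋b , w∋x₀    = vertexThrough (λ b≡x₀ → only 0<L (subst (v₀ ∋_) (sym b≡x₀) v₀∋x₀))
      in extension-length≥3 1≤L′ only v₀∋c v₁∋c v₀∋x₀ x₀≢c w∋b w∋x₀

    ends-adjacent : Adj v₀ (at L) × 1 ≤ L′
    ends-adjacent with ℕP.anyUpTo? (λ k → at k ∋? b) L
    ... | yes (k , k<L , k∋b) = b-in-earlier-vertex k<L k∋b
    ... | no none with L′ ℕP.≟ 0
    ...   | yes L′≡0 = ⊥-elim (onlyInLast-length2 L′≡0 (λ k<L k∋b → none (_ , k<L , k∋b)))
    ...   | no L′≢0  = ⊥-elim (onlyInLast-length≥3 (ℕP.n≢0⇒n>0 L′≢0) (λ k<L k∋b → none (_ , k<L , k∋b)))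

  ends-adjacent : Adj v₀ (at L) × 2 ≤ L
  ends-adjacent = via-last-edge (sym (ℕP.suc-pred L ⦃ ≢-nonZero L≢0 ⦄))
    where
    via-last-edge : ∀ {L′} → L ≡ suc L′ → Adj v₀ (at L) × 2 ≤ L
    via-last-edge L≡ with Adj⇒Meet (penultimate-adj L≡)
    ... | a , pen∋a , last∋a with otherEnd last∋a
    ...   | b , last∋b , b≢a =
      Product.map₂ (subst (2 ≤_) (sym L≡) ∘ s≤s) (LastEdge.ends-adjacent L≡ pen∋a last∋a last∋b b≢a)

  at-adjacent⇒CycNbr : ∀ {x y} → x ≤ L → y ≤ L → Adj (at x) (at y) → CycNbr (suc L) x y
  at-adjacent⇒CycNbr {x} {y} x≤L y≤L adj with ℕP.<-cmp x y
  ... | tri< x<y _ _ with chord x<y y≤L adj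
  ...   | inj₁ y≡x+1        = inj₁ (sym y≡x+1)
  ...   | inj₂ (x≡0 , y≡L) = inj₂ (inj₂ (inj₁ (x≡0 , cong suc y≡L)))
  at-adjacent⇒CycNbr x≤L y≤L adj | tri≈ _ refl _ = ⊥-elim (Adj-irrefl adj)
  at-adjacent⇒CycNbr x≤L y≤L adj | tri> _ _ y<x with chord y<x x≤L (Adj-sym adj)
  ...   | inj₁ x≡y+1        = inj₂ (inj₁ (sym x≡y+1))
  ...   | inj₂ (y≡0 , x≡L) = inj₂ (inj₂ (inj₂ (y≡0 , cong suc x≡L)))

  CycNbr⇒at-adjacent : ∀ {x y} → x ≤ L → y ≤ L → CycNbr (suc L) x y → Adj (at x) (at y)
  CycNbr⇒at-adjacent x≤L y≤L (inj₁ refl)                   = at-adj y≤L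
  CycNbr⇒at-adjacent x≤L y≤L (inj₂ (inj₁ refl))            = Adj-sym (at-adj x≤L)
  CycNbr⇒at-adjacent x≤L y≤L (inj₂ (inj₂ (inj₁ (refl , e)))) =
    subst (Adj v₀ ∘ at) (sym (ℕP.suc-injective e)) (proj₁ ends-adjacent)
  CycNbr⇒at-adjacent x≤L y≤L (inj₂ (inj₂ (inj₂ (refl , e)))) =
    Adj-sym (subst (Adj v₀ ∘ at) (sym (ℕP.suc-injective e)) (proj₁ ends-adjacent))

  inducedCycle : InducedCycle P
  inducedCycle = s≤s (proj₂ ends-adjacent) , λ a b →
      at-adjacent⇒CycNbr (bound a) (bound b) ∘ subst₂ Adj (lookup≡nth v₀ P a) (lookup≡nth v₀ P b)
    , subst₂ Adj (sym (lookup≡nth v₀ P a)) (sym (lookup≡nth v₀ P b)) ∘ CycNbr⇒at-adjacent (bound a) (bound b)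
    where
    bound : (a : Fin (suc L)) → toℕ a ≤ L
    bound a = ℕP.≤-pred (FinP.toℕ<n a)

  S-conj-closed : ∀ {x} → x ∈S S → conj x ∈S S
  S-conj-closed = conj-closed maxS (at-∈S z≤n) (at-∈S 1≤L)
    (λ v₀≡v₁ → contradiction (at-SameSupport⇒≡ z≤n 1≤L (inj₁ v₀≡v₁)) λ ())
    where
    1≤L : 1 ≤ L
    1≤L = ℕP.n≢0⇒n>0 L≢0

  P*⊆S : ∀ {y} → y ∈ map conj P → y ∈S S
  P*⊆S y∈P* with ∈-map⁻ conj y∈P*
  ... | x , x∈P , refl = S-conj-closed (All.lookup P⊆S x∈P)

  conj-isPath : IsPath S (map conj P)
  conj-isPath = (λ ()) , All.tabulate P*⊆S , LinkedP.map⁺ (Linked.map Adj-conj linked)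
              , UniqueP.map⁺ conj-injective unique

  P∩P*≡∅ : ∀ x → x ∈ P → x ∉ map conj P
  P∩P*≡∅ x x∈P x∈P* with ∈-map⁻ conj x∈P*
  ... | y , y∈P , x≡y* = conjFree x∈P y∈P x≡y*

lemma7p10 : (n : ℕ) → 4 ≤ n → (S : VSet n) → MaximalConnectedTriangleFree S →
    (P : List (Vertex n)) → MaximalGoodPath S P →
    ((∀ v₁ mid vₘ → P ≡ v₁ ∷ mid ++ vₘ ∷ [] → Adj v₁ vₘ) × InducedCycle P)
    × (IsPath S (map conj P)
       × (∀ x → x ∈ P → x ∉ map conj P)
       × (∀ v → (v ∈S S → v ∈ P ⊎ v ∈ map conj P) × (v ∈ P ⊎ v ∈ map conj P → v ∈S S)))
lemma7p10 n n≥4 S maxS [] (((P≢[] , _) , _) , _) = contradiction refl P≢[]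
lemma7p10 n n≥4 S maxS (v₀ ∷ rest) (((_ , P⊆S , linked , unique) , conjFree) , unextendable) =
    (first-last (proj₁ ends-adjacent) , inducedCycle)
  , conj-isPath
  , P∩P*≡∅
  , λ v → OnPathSupport⇒∈P∪P* ∘ S⊆OnPathSupport , Sum.[ All.lookup P⊆S , P*⊆S ]
  where open MaximalPath n≥4 maxS P⊆S linked unique conjFree unextendable
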